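{- Let $G$ be a finite graph that is not prime, with $|V(G)|\geq 4$ and $m(G)=1$. Then $p(G)=1$.
   Context: Graphs are finite, simple and undirected; $G[W]$ denotes the induced subgraph. A subset $M\subseteq V(G)$ is a module of $G$ if every vertex outside $M$ is adjacent to all elements of $M$ or to none. The modules $\emptyset$, $V(G)$, $\{v\}$ are trivial. $G$ is prime if $|V(G)|\geq 4$ and all its modules are trivial. An extension of $G$ is a graph $H$ with $V(H)\supseteq V(G)$ and $H[V(G)]=G$; a $p$-extension additionally has $|V(H)\setminus V(G)|=p$. The prime bound $p(G)$ is the least $p$ such that $G$ admits a prime $p$-extension. $\omega_M(G)$ (resp. $\alpha_M(G)$) is the largest size of a module of $G$ that is a clique (resp. a stable set) in $G$, and $m(G)=\max(\alpha_M(G),\omega_M(G))$. -}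

module Defs where

open import Data.Bool using (Bool; true; false)
open import Data.Nat using (ℕ; _+_; _≤_; _<_; _⊔_)
open import Data.Fin using (Fin; _↑ˡ_)
open import Data.Fin.Subset using (Subset; _∈_; _∉_; ∣_∣; ⁅_⁆) renaming (⊥ to ∅; ⊤ to full)
open import Data.Product using (Σ; ∃; _×_; _,_)
open import Data.Sum using (_⊎_)
open import Relation.Nullary using (¬_)
open import Relation.Binary.PropositionalEquality using (_≡_; _≢_)

record Graph (n : ℕ) : Set where
  field
    adj    : Fin n → Fin n → Bool
    symm   : ∀ x y → adj x y ≡ adj y x
    irrefl : ∀ x → adj x x ≡ false
open Graph public

IsModule : ∀ {n} → Graph n → Subset n → Set
IsModule G M = ∀ x → x ∉ M → ∀ y z → y ∈ M → z ∈ M → adj G x y ≡ adj G x z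

IsTrivial : ∀ {n} → Subset n → Set
IsTrivial M = (M ≡ ∅) ⊎ ((M ≡ full) ⊎ (∃ λ v → M ≡ ⁅ v ⁆))

IsPrime : ∀ {n} → Graph n → Set
IsPrime {n} G = (4 ≤ n) × (∀ M → IsModule G M → IsTrivial M)

IsClique IsStable : ∀ {n} → Graph n → Subset n → Set
IsClique G M = ∀ x y → x ∈ M → y ∈ M → x ≢ y → adj G x y ≡ true
IsStable G M = ∀ x y → x ∈ M → y ∈ M → x ≢ y → adj G x y ≡ false

IsMaxModuleSize : ∀ {n} → Graph n → (Subset n → Set) → ℕ → Set
IsMaxModuleSize G P k =
  (∃ λ M → IsModule G M × P M × ∣ M ∣ ≡ k) ×
  (∀ M → IsModule G M → P M → ∣ M ∣ ≤ k)

IsOmegaM IsAlphaM : ∀ {n} → Graph n → ℕ → Set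
IsOmegaM G = IsMaxModuleSize G (IsClique G)
IsAlphaM G = IsMaxModuleSize G (IsStable G)

IsMG : ∀ {n} → Graph n → ℕ → Set
IsMG G k = Σ ℕ λ a → Σ ℕ λ b → IsAlphaM G a × IsOmegaM G b × (a ⊔ b ≡ k)

-- H is a p-extension of G: vertices of G are the first n vertices of H
-- (G is identified with its image under _↑ˡ p), and H[V(G)] = G.
IsExtension : ∀ {n p} → Graph n → Graph (n + p) → Set
IsExtension {n} {p} G H = ∀ x y → adj H (x ↑ˡ p) (y ↑ˡ p) ≡ adj G x y

HasPrimeExt : ∀ {n} → Graph n → ℕ → Set
HasPrimeExt {n} G p = Σ (Graph (n + p)) λ H → IsExtension G H × IsPrime H

IsPrimeBound : ∀ {n} → Graph n → ℕ → Set
IsPrimeBound G p = HasPrimeExt G p × (∀ q → q < p → ¬ HasPrimeExt G q)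

-- A graph with m(G) = 1 has no twins, and then its minimal modules with at least two vertices
-- are pairwise disjoint. Fix one of them, K₁ ∋ k₁, and add a vertex adjacent to one chosen vertex
-- of every minimal module and to those vertices outside all minimal modules that are not adjacent
-- to k₁. The new vertex distinguishes two vertices of every minimal module, so a module avoiding it
-- has at most one old vertex. A module containing it and a proper nonempty part A of G meets every
-- minimal module; this leaves a vertex b ∉ A outside all minimal modules, whose adjacency to the new
-- vertex must both equal (A ∩ K₁ ≠ ∅) and differ from (by construction) its adjacency to k₁.
-- Finally a prime 0-extension of G would be G itself.
module Submission where

open import Defs
open import Data.Nat using (ℕ; _≤_)
open import Relation.Nullary using (¬_)

open import Data.Bool using (Bool; true; false; not)
open import Data.Bool.Properties using (not-¬) renaming (_≟_ to _≟ᵇ_)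
open import Data.Empty using (⊥-elim)
open import Data.Fin as Fin using (Fin; zero; suc; cast; _↑ˡ_; _↑ʳ_; splitAt)
open import Data.Fin.Properties
  using (_≟_; any?; all?; toℕ-injective; toℕ-cast; toℕ-↑ˡ; ↑ˡ-injective; splitAt-↑ˡ; splitAt-↑ʳ; join-splitAt)
  renaming (≤-antisym to ≤ᶠ-antisym; _≤?_ to _≤ᶠ?_)
open import Data.Fin.Subset using (Subset; inside; outside; _∈_; _∉_; _⊆_; _⊈_; _⊂_; Nonempty; ∣_∣; ⁅_⁆; _∩_; _∪_; ∁)
open import Data.Fin.Subset.Induction using (Acc; acc; ⊂-wellFounded)
open import Data.Fin.Subset.Properties
  using (_∈?_; _⊆?_; _⊂?_; nonempty?; anySubset?; Empty-unique; ∉⊥; ∈⊤; ⊆⊤; ⊆-antisym; x∈⁅x⁆; x∈⁅y⁆⇒x≡y;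
         x∈p∩q⁺; x∈p∩q⁻; x∈∁p⇒x∉p; x∉p⇒x∈∁p; x∈p∪q⁺; x∈p∪q⁻; p∩q⊆p; p⊂q⇒∣p∣<∣q∣; ∣⁅x⁆∣≡1)
open import Data.Nat using (zero; suc; _+_; _<_; z≤n; s≤s)
open import Data.Nat.Properties using (≤-trans; m≤m+n; m≤m⊔n; m≤n⊔m; +-identityʳ; <⇒≱)
open import Data.Product using (∃; ∃₂; _×_; _,_; proj₁; proj₂)
open import Data.Sum using (_⊎_; inj₁; inj₂)
open import Data.Vec using (_∷_; here; there; lookup; tabulate)
open import Data.Vec.Properties using ([]=⇒lookup; lookup⇒[]=; lookup∘tabulate)
open import Function using (_∘_; id)
open import Relation.Nullary using (Dec; yes; no; contradiction)
open import Relation.Nullary.Decidable using (decidable-stable; ¬?; _×-dec_; _→-dec_)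
open import Relation.Unary using (Decidable)
open import Relation.Binary.PropositionalEquality

module _ {n : ℕ} where

  Subsingleton : Subset n → Set
  Subsingleton p = ∀ {x y} → x ∈ p → y ∈ p → x ≡ y

  HasTwoElements : Subset n → Set
  HasTwoElements p = ∃₂ λ x y → x ≢ y × x ∈ p × y ∈ p

  Proper : Subset n → Set
  Proper p = ∃ λ x → x ∉ p

  IsLeast : Subset n → Fin n → Set
  IsLeast p u = u ∈ p × (∀ w → w ∈ p → u Fin.≤ w)

  hasTwoElements? : Decidable HasTwoElements
  hasTwoElements? p = any? λ x → any? λ y → ¬? (x ≟ y) ×-dec x ∈? p ×-dec y ∈? p

  proper? : Decidable Proper
  proper? p = any? λ x → ¬? (x ∈? p)

  isLeast? : ∀ p u → Dec (IsLeast p u)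
  isLeast? p u = u ∈? p ×-dec all? λ w → w ∈? p →-dec u ≤ᶠ? w

  ⊈⇒∃∉ : ∀ {p q : Subset n} → p ⊈ q → ∃ λ x → x ∈ p × x ∉ q
  ⊈⇒∃∉ {p} {q} p⊈q with any? (λ x → x ∈? p ×-dec ¬? (x ∈? q))
  ... | yes witness = witness
  ... | no none = contradiction (λ {x} x∈p → decidable-stable (x ∈? q) λ x∉q → none (x , x∈p , x∉q)) p⊈q

  ¬hasTwoElements⇒subsingleton : ∀ {p} → ¬ HasTwoElements p → Subsingleton p
  ¬hasTwoElements⇒subsingleton ¬two {x} {y} x∈p y∈p with x ≟ y
  ... | yes x≡y = x≡y
  ... | no x≢y = contradiction (x , y , x≢y , x∈p , y∈p) ¬two

  ∈-∖⁻ : ∀ {p q : Subset n} {x} → x ∈ p ∩ ∁ q → x ∈ p × x ∉ q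
  ∈-∖⁻ {p} {q} x∈ = proj₁ (x∈p∩q⁻ p (∁ q) x∈) , x∈∁p⇒x∉p (proj₂ (x∈p∩q⁻ p (∁ q) x∈))

  subsingleton-∩-∖⇒≡pair : ∀ {p q : Subset n} {c d} → Subsingleton (p ∩ q) → Subsingleton (p ∩ ∁ q) →
                           c ∈ p ∩ q → d ∈ p ∩ ∁ q → p ≡ ⁅ c ⁆ ∪ ⁅ d ⁆
  subsingleton-∩-∖⇒≡pair {p} {q} {c} {d} single∩ single∖ c∈p∩q d∈p∖q = ⊆-antisym p⊆pair pair⊆p
    where
      p⊆pair : p ⊆ ⁅ c ⁆ ∪ ⁅ d ⁆
      p⊆pair {z} z∈p with z ∈? q
      ... | yes z∈q = x∈p∪q⁺ (inj₁ (subst (_∈ ⁅ c ⁆) (sym (single∩ (x∈p∩q⁺ (z∈p , z∈q)) c∈p∩q)) (x∈⁅x⁆ c)))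
      ... | no z∉q = x∈p∪q⁺ (inj₂ (subst (_∈ ⁅ d ⁆) (sym (single∖ (x∈p∩q⁺ (z∈p , x∉p⇒x∈∁p z∉q)) d∈p∖q)) (x∈⁅x⁆ d)))
      pair⊆p : ⁅ c ⁆ ∪ ⁅ d ⁆ ⊆ p
      pair⊆p z∈pair with x∈p∪q⁻ ⁅ c ⁆ ⁅ d ⁆ z∈pair
      ... | inj₁ z∈⁅c⁆ = subst (_∈ p) (sym (x∈⁅y⁆⇒x≡y c z∈⁅c⁆)) (proj₁ (x∈p∩q⁻ p q c∈p∩q))
      ... | inj₂ z∈⁅d⁆ = subst (_∈ p) (sym (x∈⁅y⁆⇒x≡y d z∈⁅d⁆)) (proj₁ (∈-∖⁻ d∈p∖q))

  another-element : ∀ {p} → HasTwoElements p → ∀ u → ∃ λ w → w ∈ p × w ≢ u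
  another-element (x , y , x≢y , x∈p , y∈p) u with x ≟ u
  ... | yes refl = y , y∈p , x≢y ∘ sym
  ... | no x≢u = x , x∈p , x≢u

  2≤∣p∣ : ∀ {p} → HasTwoElements p → 2 ≤ ∣ p ∣
  2≤∣p∣ {p} (x , y , x≢y , x∈p , y∈p) =
    subst (_< ∣ p ∣) (∣⁅x⁆∣≡1 x) (p⊂q⇒∣p∣<∣q∣ (⁅x⁆⊆p , y , y∈p , x≢y ∘ sym ∘ x∈⁅y⁆⇒x≡y x))
    where
      ⁅x⁆⊆p : ⁅ x ⁆ ⊆ p
      ⁅x⁆⊆p z∈⁅x⁆ = subst (_∈ p) (sym (x∈⁅y⁆⇒x≡y x z∈⁅x⁆)) x∈p

least-element : ∀ {n} {p : Subset n} → Nonempty p → ∃ (IsLeast p)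
least-element {p = inside ∷ p} _ = zero , here , λ _ _ → z≤n
least-element {p = outside ∷ p} (suc x , there x∈p) with least-element (x , x∈p)
... | u , u∈p , u≤ = suc u , there u∈p , λ { (suc w) (there w∈p) → s≤s (u≤ w w∈p) }

module _ {n : ℕ} {p : Subset n} where

  subsingleton⇒trivial : Subsingleton p → IsTrivial p
  subsingleton⇒trivial single with nonempty? p
  ... | no empty = inj₁ (Empty-unique empty)
  ... | yes (x , x∈p) = inj₂ (inj₂ (x , ⊆-antisym (λ y∈p → subst (_∈ ⁅ x ⁆) (single x∈p y∈p) (x∈⁅x⁆ x))
                                                  (λ y∈⁅x⁆ → subst (_∈ p) (sym (x∈⁅y⁆⇒x≡y x y∈⁅x⁆)) x∈p)))

  total⇒trivial : (∀ x → x ∈ p) → IsTrivial p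
  total⇒trivial total = inj₂ (inj₁ (⊆-antisym ⊆⊤ λ {x} _ → total x))

  trivial⇒total⊎subsingleton : IsTrivial p → (∀ x → x ∈ p) ⊎ Subsingleton p
  trivial⇒total⊎subsingleton (inj₁ refl) = inj₂ λ x∈∅ → ⊥-elim (∉⊥ x∈∅)
  trivial⇒total⊎subsingleton (inj₂ (inj₁ refl)) = inj₁ λ _ → ∈⊤
  trivial⇒total⊎subsingleton (inj₂ (inj₂ (v , refl))) = inj₂ λ x∈⁅v⁆ y∈⁅v⁆ → trans (x∈⁅y⁆⇒x≡y v x∈⁅v⁆) (sym (x∈⁅y⁆⇒x≡y v y∈⁅v⁆))

  trivial⊎hasTwoElements×proper : IsTrivial p ⊎ (HasTwoElements p × Proper p)
  trivial⊎hasTwoElements×proper with hasTwoElements? p | proper? p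
  ... | no ¬two | _ = inj₁ (subsingleton⇒trivial (¬hasTwoElements⇒subsingleton ¬two))
  ... | yes two | yes proper = inj₂ (two , proper)
  ... | yes _ | no ¬proper = inj₁ (total⇒trivial λ x → decidable-stable (x ∈? p) λ x∉p → ¬proper (x , x∉p))

preimage : ∀ {k m} → (Fin k → Fin m) → Subset m → Subset k
preimage f p = tabulate (λ x → lookup p (f x))

module _ {k m} {f : Fin k → Fin m} {p : Subset m} {x : Fin k} where

  ∈-preimage⁺ : f x ∈ p → x ∈ preimage f p
  ∈-preimage⁺ fx∈p = lookup⇒[]= x _ (trans (lookup∘tabulate _ x) ([]=⇒lookup fx∈p))

  ∈-preimage⁻ : x ∈ preimage f p → f x ∈ p
  ∈-preimage⁻ x∈ = lookup⇒[]= (f x) p (trans (sym (lookup∘tabulate _ x)) ([]=⇒lookup x∈))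

isModule-preimage : ∀ {k m} {G : Graph m} {F : Graph k} (f : Fin k → Fin m) →
                    (∀ a b → adj G (f a) (f b) ≡ adj F a b) →
                    ∀ {M} → IsModule G M → IsModule F (preimage f M)
isModule-preimage {G = G} {F} f f-adj {M} M-mod x x∉ y z y∈ z∈ = begin
  adj F x y          ≡⟨ sym (f-adj x y) ⟩
  adj G (f x) (f y)  ≡⟨ M-mod (f x) (x∉ ∘ ∈-preimage⁺) (f y) (f z) (∈-preimage⁻ y∈) (∈-preimage⁻ z∈) ⟩
  adj G (f x) (f z)  ≡⟨ f-adj x z ⟩
  adj F x z          ∎
  where open ≡-Reasoning

TwinFree : ∀ {n} → Graph n → Set
TwinFree G = ∀ {x y} → x ≢ y → ¬ IsModule G (⁅ x ⁆ ∪ ⁅ y ⁆)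

module _ {n : ℕ} (G : Graph n) where

  isModule? : Decidable (IsModule G)
  isModule? M = all? λ x → ¬? (x ∈? M) →-dec all? λ y → all? λ z →
                  y ∈? M →-dec z ∈? M →-dec adj G x y ≟ᵇ adj G x z

  isModule-∩ : ∀ {A B} → IsModule G A → IsModule G B → IsModule G (A ∩ B)
  isModule-∩ {A} {B} A-mod B-mod x x∉A∩B y z y∈A∩B z∈A∩B with x ∈? A
  ... | yes x∈A = B-mod x (λ x∈B → x∉A∩B (x∈p∩q⁺ (x∈A , x∈B))) y z
                     (proj₂ (x∈p∩q⁻ A B y∈A∩B)) (proj₂ (x∈p∩q⁻ A B z∈A∩B))
  ... | no x∉A = A-mod x x∉A y z (proj₁ (x∈p∩q⁻ A B y∈A∩B)) (proj₁ (x∈p∩q⁻ A B z∈A∩B))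

  -- A vertex of A outside A ∖ B lies in B, so it is linked to A ∖ B as w is.
  isModule-∖ : ∀ {A B w} → IsModule G A → IsModule G B → w ∈ B → w ∉ A → IsModule G (A ∩ ∁ B)
  isModule-∖ {A} {B} {w} A-mod B-mod w∈B w∉A x x∉A∖B y y′ y∈A∖B y′∈A∖B
    with ∈-∖⁻ y∈A∖B | ∈-∖⁻ y′∈A∖B | x ∈? A
  ... | y∈A , _ | y′∈A , _ | no x∉A = A-mod x x∉A y y′ y∈A y′∈A
  ... | y∈A , y∉B | y′∈A , y′∉B | yes x∈A = begin
    adj G x y   ≡⟨ symm G x y ⟩
    adj G y x   ≡⟨ B-mod y y∉B x w x∈B w∈B ⟩
    adj G y w   ≡⟨ symm G y w ⟩
    adj G w y   ≡⟨ A-mod w w∉A y y′ y∈A y′∈A ⟩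
    adj G w y′  ≡⟨ symm G w y′ ⟩
    adj G y′ w  ≡⟨ B-mod y′ y′∉B w x w∈B x∈B ⟩
    adj G y′ x  ≡⟨ symm G y′ x ⟩
    adj G x y′  ∎
    where
      open ≡-Reasoning
      x∈B : x ∈ B
      x∈B = decidable-stable (x ∈? B) λ x∉B → x∉A∖B (x∈p∩q⁺ (x∈A , x∉p⇒x∈∁p x∉B))

  adj-within-pair : ∀ {x y u w} → u ∈ ⁅ x ⁆ ∪ ⁅ y ⁆ → w ∈ ⁅ x ⁆ ∪ ⁅ y ⁆ → u ≢ w → adj G u w ≡ adj G x y
  adj-within-pair {x} {y} u∈ w∈ u≢w with x∈p∪q⁻ ⁅ x ⁆ ⁅ y ⁆ u∈ | x∈p∪q⁻ ⁅ x ⁆ ⁅ y ⁆ w∈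
  ... | inj₁ u∈⁅x⁆ | inj₁ w∈⁅x⁆ = contradiction (trans (x∈⁅y⁆⇒x≡y x u∈⁅x⁆) (sym (x∈⁅y⁆⇒x≡y x w∈⁅x⁆))) u≢w
  ... | inj₁ u∈⁅x⁆ | inj₂ w∈⁅y⁆ = cong₂ (adj G) (x∈⁅y⁆⇒x≡y x u∈⁅x⁆) (x∈⁅y⁆⇒x≡y y w∈⁅y⁆)
  ... | inj₂ u∈⁅y⁆ | inj₁ w∈⁅x⁆ = trans (cong₂ (adj G) (x∈⁅y⁆⇒x≡y y u∈⁅y⁆) (x∈⁅y⁆⇒x≡y x w∈⁅x⁆)) (symm G y x)
  ... | inj₂ u∈⁅y⁆ | inj₂ w∈⁅y⁆ = contradiction (trans (x∈⁅y⁆⇒x≡y y u∈⁅y⁆) (sym (x∈⁅y⁆⇒x≡y y w∈⁅y⁆))) u≢w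

  -- A pair is a clique or a stable set, so a twin pair would be a module of size 2 > m(G).
  m≡1⇒twinFree : IsMG G 1 → TwinFree G
  m≡1⇒twinFree (a , b , (_ , α-max) , (_ , ω-max) , a⊔b≡1) {x} {y} x≢y pair-mod =
    <⇒≱ (2≤∣p∣ (x , y , x≢y , x∈p∪q⁺ (inj₁ (x∈⁅x⁆ x)) , x∈p∪q⁺ (inj₂ (x∈⁅x⁆ y)))) ∣pair∣≤1
    where
      ∣pair∣≤1 : ∣ ⁅ x ⁆ ∪ ⁅ y ⁆ ∣ ≤ 1
      ∣pair∣≤1 with adj G x y in xy
      ... | true  = ≤-trans (ω-max _ pair-mod λ _ _ u∈ w∈ u≢w → trans (adj-within-pair u∈ w∈ u≢w) xy)
                            (subst (b ≤_) a⊔b≡1 (m≤n⊔m a b))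
      ... | false = ≤-trans (α-max _ pair-mod λ _ _ u∈ w∈ u≢w → trans (adj-within-pair u∈ w∈ u≢w) xy)
                            (subst (a ≤_) a⊔b≡1 (m≤m⊔n a b))

  ¬prime⇒nontrivialModule : 4 ≤ n → ¬ IsPrime G → ∃ λ M → IsModule G M × HasTwoElements M × Proper M
  ¬prime⇒nontrivialModule 4≤n ¬prime
    with anySubset? (λ M → isModule? M ×-dec hasTwoElements? M ×-dec proper? M)
  ... | yes found = found
  ... | no none = contradiction (4≤n , trivial) ¬prime
    where
      trivial : ∀ M → IsModule G M → IsTrivial M
      trivial M M-mod with trivial⊎hasTwoElements×proper {p = M}
      ... | inj₁ M-trivial = M-trivial
      ... | inj₂ (two , proper) = contradiction (M , M-mod , two , proper) none

  Minimal : Subset n → Set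
  Minimal K = ∀ {K′} → IsModule G K′ → HasTwoElements K′ → K′ ⊆ K → K ⊆ K′

  record IsMinimalModule (K : Subset n) : Set where
    field
      isModule       : IsModule G K
      hasTwoElements : HasTwoElements K
      proper         : Proper K
      minimal        : Minimal K

  SmallerModule : Subset n → Subset n → Set
  SmallerModule K K′ = IsModule G K′ × HasTwoElements K′ × K′ ⊂ K

  smallerModule? : ∀ K → Decidable (SmallerModule K)
  smallerModule? K K′ = isModule? K′ ×-dec hasTwoElements? K′ ×-dec K′ ⊂? K

  no-smallerModule⇒minimal : ∀ {K} → ¬ ∃ (SmallerModule K) → Minimal K
  no-smallerModule⇒minimal {K} none {K′} K′-mod K′-two K′⊆K =
    decidable-stable (K ⊆? K′) λ K⊈K′ → none (K′ , K′-mod , K′-two , K′⊆K , ⊈⇒∃∉ K⊈K′)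

  minimal? : Decidable Minimal
  minimal? K with anySubset? (smallerModule? K)
  ... | no none = yes (no-smallerModule⇒minimal none)
  ... | yes (K′ , K′-mod , K′-two , K′⊆K , x , x∈K , x∉K′) = no λ K-min → x∉K′ (K-min K′-mod K′-two K′⊆K x∈K)

  isMinimalModule? : Decidable IsMinimalModule
  isMinimalModule? K with isModule? K ×-dec hasTwoElements? K ×-dec proper? K ×-dec minimal? K
  ... | yes (m , t , p , min) = yes record { isModule = m ; hasTwoElements = t ; proper = p ; minimal = min }
  ... | no ¬min = no λ K-min → ¬min (isModule K-min , hasTwoElements K-min , proper K-min , minimal K-min)
    where open IsMinimalModule

  minimalModule-⊆ : ∀ {K} → IsModule G K → HasTwoElements K → Proper K → ∃ λ K₀ → IsMinimalModule K₀ × K₀ ⊆ K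
  minimalModule-⊆ {K} = go K (⊂-wellFounded K)
    where
      go : ∀ K → Acc _⊂_ K → IsModule G K → HasTwoElements K → Proper K → ∃ λ K₀ → IsMinimalModule K₀ × K₀ ⊆ K
      go K (acc smaller) K-mod K-two K-proper
        with anySubset? (smallerModule? K)
      ... | no none = K , record { isModule = K-mod ; hasTwoElements = K-two ; proper = K-proper
                                 ; minimal = no-smallerModule⇒minimal none } , id
      ... | yes (K′ , K′-mod , K′-two , K′⊂K@(K′⊆K , _))
        with go K′ (smaller K′⊂K) K′-mod K′-two (proj₁ K-proper , proj₂ K-proper ∘ K′⊆K)
      ...   | K₀ , K₀-min , K₀⊆K′ = K₀ , K₀-min , K′⊆K ∘ K₀⊆K′

  ¬prime⇒minimalModule : 4 ≤ n → ¬ IsPrime G → ∃ IsMinimalModule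
  ¬prime⇒minimalModule 4≤n ¬prime with ¬prime⇒nontrivialModule 4≤n ¬prime
  ... | M , M-mod , M-two , M-proper with minimalModule-⊆ M-mod M-two M-proper
  ...   | K , K-min , _ = K , K-min

  module _ (twinFree : TwinFree G) where
    open IsMinimalModule

    -- If A ⊈ K, both K ∩ A and K ∖ A are modules; minimality of K forces K ∩ A to be a
    -- singleton {c} and K ∖ A to have at most one element d, and then {c , d} = K would be twins.
    minimal⊆module : ∀ {K A c} → IsMinimalModule K → IsModule G A → HasTwoElements A → c ∈ K → c ∈ A → K ⊆ A
    minimal⊆module {K} {A} {c} K-min A-mod A-two c∈K c∈A with A ⊆? K
    ... | yes A⊆K = minimal K-min A-mod A-two A⊆K
    ... | no A⊈K with ⊈⇒∃∉ A⊈K | hasTwoElements? (K ∩ A) | hasTwoElements? (K ∩ ∁ A) | K ⊆? A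
    ...   | _ | yes two | _ | _ =
      λ x∈K → proj₂ (x∈p∩q⁻ K A (minimal K-min (isModule-∩ (isModule K-min) A-mod) two (p∩q⊆p K A) x∈K))
    ...   | w , w∈A , w∉K | no _ | yes two | _ = contradiction c∈A (proj₂ (∈-∖⁻ c∈K∖A))
      where c∈K∖A = minimal K-min (isModule-∖ (isModule K-min) A-mod w∈A w∉K) two (p∩q⊆p K (∁ A)) c∈K
    ...   | _ | no _ | no _ | yes K⊆A = K⊆A
    ...   | _ | no ¬two∩ | no ¬two∖ | no K⊈A with ⊈⇒∃∉ K⊈A
    ...     | d , d∈K , d∉A = contradiction (subst (IsModule G) K≡pair (isModule K-min)) (twinFree c≢d)
      where
        c≢d : c ≢ d
        c≢d refl = d∉A c∈A
        K≡pair : K ≡ ⁅ c ⁆ ∪ ⁅ d ⁆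
        K≡pair = subsingleton-∩-∖⇒≡pair (¬hasTwoElements⇒subsingleton ¬two∩) (¬hasTwoElements⇒subsingleton ¬two∖)
                   (x∈p∩q⁺ (c∈K , c∈A)) (x∈p∩q⁺ (d∈K , x∉p⇒x∈∁p d∉A))

    minimal-overlap⇒⊆ : ∀ {K K′ x} → IsMinimalModule K → IsMinimalModule K′ → x ∈ K → x ∈ K′ → K ⊆ K′
    minimal-overlap⇒⊆ K-min K′-min = minimal⊆module K-min (isModule K′-min) (hasTwoElements K′-min)

module _ {n : ℕ} (G : Graph n) (N : Fin n → Bool) where

  private
    adj⊎ : Fin n ⊎ Fin 1 → Fin n ⊎ Fin 1 → Bool
    adj⊎ (inj₁ x) (inj₁ y) = adj G x y
    adj⊎ (inj₁ x) (inj₂ _) = N x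
    adj⊎ (inj₂ _) (inj₁ y) = N y
    adj⊎ (inj₂ _) (inj₂ _) = false

    adj⊎-symm : ∀ s t → adj⊎ s t ≡ adj⊎ t s
    adj⊎-symm (inj₁ x) (inj₁ y) = symm G x y
    adj⊎-symm (inj₁ _) (inj₂ _) = refl
    adj⊎-symm (inj₂ _) (inj₁ _) = refl
    adj⊎-symm (inj₂ _) (inj₂ _) = refl

    adj⊎-irrefl : ∀ s → adj⊎ s s ≡ false
    adj⊎-irrefl (inj₁ x) = irrefl G x
    adj⊎-irrefl (inj₂ _) = refl

  extend : Graph (n + 1)
  extend = record
    { adj    = λ a b → adj⊎ (splitAt n a) (splitAt n b)
    ; symm   = λ a b → adj⊎-symm (splitAt n a) (splitAt n b)
    ; irrefl = λ a → adj⊎-irrefl (splitAt n a)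
    }

  new : Fin (n + 1)
  new = n ↑ʳ zero

  extend-isExtension : IsExtension G extend
  extend-isExtension x y rewrite splitAt-↑ˡ n x 1 | splitAt-↑ˡ n y 1 = refl

  adj-extend-new : ∀ x → adj extend (x ↑ˡ 1) new ≡ N x
  adj-extend-new x rewrite splitAt-↑ˡ n x 1 | splitAt-↑ʳ n 1 zero = refl

  old⊎new : ∀ a → (∃ λ x → a ≡ x ↑ˡ 1) ⊎ a ≡ new
  old⊎new a with splitAt n a | join-splitAt n 1 a
  ... | inj₁ x    | a≡x = inj₁ (x , sym a≡x)
  ... | inj₂ zero | a≡new = inj₂ (sym a≡new)

  module _ {M : Subset (n + 1)} where

    preimage-subsingleton⇒subsingleton : new ∉ M → Subsingleton (preimage (_↑ˡ 1) M) → Subsingleton M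
    preimage-subsingleton⇒subsingleton new∉M single {a} {b} a∈M b∈M with old⊎new a | old⊎new b
    ... | inj₁ (x , refl) | inj₁ (y , refl) = cong (_↑ˡ 1) (single (∈-preimage⁺ a∈M) (∈-preimage⁺ b∈M))
    ... | inj₂ refl | _ = contradiction a∈M new∉M
    ... | _ | inj₂ refl = contradiction b∈M new∉M

    preimage-empty⇒subsingleton : ¬ Nonempty (preimage (_↑ˡ 1) M) → Subsingleton M
    preimage-empty⇒subsingleton empty {a} {b} a∈M b∈M with old⊎new a | old⊎new b
    ... | inj₁ (x , refl) | _ = contradiction (x , ∈-preimage⁺ a∈M) empty
    ... | _ | inj₁ (y , refl) = contradiction (y , ∈-preimage⁺ b∈M) empty
    ... | inj₂ a≡new | inj₂ b≡new = trans a≡new (sym b≡new)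

    preimage-total⇒total : new ∈ M → (∀ x → x ∈ preimage (_↑ˡ 1) M) → ∀ a → a ∈ M
    preimage-total⇒total new∈M total a with old⊎new a
    ... | inj₁ (x , refl) = ∈-preimage⁻ (total x)
    ... | inj₂ refl = new∈M

module _ {n : ℕ} (G : Graph n) where

  InMinimalModule : Fin n → Set
  InMinimalModule u = ∃ λ K → IsMinimalModule G K × u ∈ K

  inMinimalModule? : Decidable InMinimalModule
  inMinimalModule? u = anySubset? λ K → isMinimalModule? G K ×-dec u ∈? K

  SplitsMinimalModules : (Fin n → Bool) → Set
  SplitsMinimalModules N = ∀ {K} → IsMinimalModule G K → ∃₂ λ m w → m ∈ K × w ∈ K × N m ≡ true × N w ≡ false

module _ {n : ℕ} {G : Graph n} (twinFree : TwinFree G)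
         {K₁ : Subset n} (K₁-min : IsMinimalModule G K₁) {k₁ : Fin n} (k₁∈K₁ : k₁ ∈ K₁)
         {N : Fin n → Bool} (N-splits : SplitsMinimalModules G N)
         (N-outside : ∀ {u} → ¬ InMinimalModule G u → N u ≡ not (adj G u k₁)) where

  open IsMinimalModule

  private
    H : Graph (n + 1)
    H = extend G N

  hasTwoElements⇒⊇minimal : ∀ {A} → IsModule G A → HasTwoElements A → ∃ λ K → IsMinimalModule G K × K ⊆ A
  hasTwoElements⇒⊇minimal {A} A-mod A-two with proper? A
  ... | yes A-proper = minimalModule-⊆ G A-mod A-two A-proper
  ... | no ¬proper = K₁ , K₁-min , λ {x} _ → decidable-stable (x ∈? A) λ x∉A → ¬proper (x , x∉A)

  module _ {M : Subset (n + 1)} (M-mod : IsModule H M) where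

    private
      A : Subset n
      A = preimage (_↑ˡ 1) M

    A-mod : IsModule G A
    A-mod = isModule-preimage {G = H} {F = G} (_↑ˡ 1) (extend-isExtension G N) M-mod

    -- Otherwise A contains a minimal module, on which adjacency to new (that is, N) is not constant.
    new∉M⇒subsingleton : new G N ∉ M → Subsingleton M
    new∉M⇒subsingleton new∉M = preimage-subsingleton⇒subsingleton G N new∉M (¬hasTwoElements⇒subsingleton ¬two)
      where
        N≡adj-new : ∀ x → N x ≡ adj H (new G N) (x ↑ˡ 1)
        N≡adj-new x = trans (sym (adj-extend-new G N x)) (symm H (x ↑ˡ 1) (new G N))

        ¬two : ¬ HasTwoElements A
        ¬two A-two with hasTwoElements⇒⊇minimal A-mod A-two
        ... | K , K-min , K⊆A with N-splits K-min
        ...   | m , w , m∈K , w∈K , Nm≡true , Nw≡false = contradiction (begin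
          true                      ≡⟨ sym Nm≡true ⟩
          N m                       ≡⟨ N≡adj-new m ⟩
          adj H (new G N) (m ↑ˡ 1)  ≡⟨ M-mod (new G N) new∉M _ _ (∈-preimage⁻ (K⊆A m∈K)) (∈-preimage⁻ (K⊆A w∈K)) ⟩
          adj H (new G N) (w ↑ˡ 1)  ≡⟨ sym (N≡adj-new w) ⟩
          N w                       ≡⟨ Nw≡false ⟩
          false                     ∎) λ ()
          where open ≡-Reasoning

    module _ (new∈M : new G N ∈ M) where

      N≡adj : ∀ {x c} → x ∉ A → c ∈ A → N x ≡ adj G x c
      N≡adj {x} {c} x∉A c∈A = begin
        N x                       ≡⟨ sym (adj-extend-new G N x) ⟩
        adj H (x ↑ˡ 1) (new G N)  ≡⟨ M-mod (x ↑ˡ 1) (x∉A ∘ ∈-preimage⁺) _ _ new∈M (∈-preimage⁻ c∈A) ⟩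
        adj H (x ↑ˡ 1) (c ↑ˡ 1)   ≡⟨ extend-isExtension G N x c ⟩
        adj G x c                 ∎
        where open ≡-Reasoning

      -- Otherwise the vertices of K on which N differs lie outside A, so N agrees there with
      -- adjacency to a ∈ A ∖ K, which is constant on K.
      minimal-meets : ∀ {a K} → a ∈ A → IsMinimalModule G K → ∃ λ c → c ∈ K × c ∈ A
      minimal-meets {a} {K} a∈A K-min with any? (λ c → c ∈? K ×-dec c ∈? A)
      ... | yes meet = meet
      ... | no disjoint with N-splits K-min
      ...   | m , w , m∈K , w∈K , Nm≡true , Nw≡false = contradiction (begin
        true       ≡⟨ sym Nm≡true ⟩
        N m        ≡⟨ N≡adj (λ m∈A → disjoint (m , m∈K , m∈A)) a∈A ⟩
        adj G m a  ≡⟨ symm G m a ⟩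
        adj G a m  ≡⟨ isModule K-min a (λ a∈K → disjoint (a , a∈K , a∈A)) m w m∈K w∈K ⟩
        adj G a w  ≡⟨ symm G a w ⟩
        adj G w a  ≡⟨ sym (N≡adj (λ w∈A → disjoint (w , w∈K , w∈A)) a∈A) ⟩
        N w        ≡⟨ Nw≡false ⟩
        false      ∎) λ ()
        where open ≡-Reasoning

      outsider : ∀ {a} → a ∈ A → Proper A → ∃ λ b → b ∉ A × ¬ InMinimalModule G b
      outsider {a} a∈A (b₀ , b₀∉A) with hasTwoElements? A
      ... | yes A-two = b₀ , b₀∉A , b₀-outside
        where
          b₀-outside : ¬ InMinimalModule G b₀
          b₀-outside (K , K-min , b₀∈K) with minimal-meets a∈A K-min
          ... | c , c∈K , c∈A = b₀∉A (minimal⊆module G twinFree K-min A-mod A-two c∈K c∈A b₀∈K)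
      ... | no ¬two with minimal-meets a∈A K₁-min | proper K₁-min
      ...   | c , c∈K₁ , c∈A | b , b∉K₁ = b , b∉A , b-outside
        where
          single = ¬hasTwoElements⇒subsingleton ¬two
          b∉A : b ∉ A
          b∉A b∈A = b∉K₁ (subst (_∈ K₁) (single c∈A b∈A) c∈K₁)
          b-outside : ¬ InMinimalModule G b
          b-outside (K , K-min , b∈K) with minimal-meets a∈A K-min
          ... | c′ , c′∈K , c′∈A =
            b∉K₁ (minimal-overlap⇒⊆ G twinFree K-min K₁-min (subst (_∈ K) (single c′∈A c∈A) c′∈K) c∈K₁ b∈K)

      ¬proper : ∀ {a} → a ∈ A → ¬ Proper A
      ¬proper a∈A A-proper with outsider a∈A A-proper | minimal-meets a∈A K₁-min
      ... | b , b∉A , b-outside | c , c∈K₁ , c∈A =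
        not-¬ (trans (N≡adj b∉A c∈A) (isModule K₁-min b b∉K₁ c k₁ c∈K₁ k₁∈K₁)) (N-outside b-outside)
        where
          b∉K₁ : b ∉ K₁
          b∉K₁ b∈K₁ = b-outside (K₁ , K₁-min , b∈K₁)

  extend-isPrime : 4 ≤ n → IsPrime H
  extend-isPrime 4≤n = ≤-trans 4≤n (m≤m+n n 1) , trivial
    where
      trivial : ∀ M → IsModule H M → IsTrivial M
      trivial M M-mod with new G N ∈? M
      ... | no new∉M = subsingleton⇒trivial (new∉M⇒subsingleton M-mod new∉M)
      ... | yes new∈M with nonempty? (preimage (_↑ˡ 1) M) | proper? (preimage (_↑ˡ 1) M)
      ...   | no empty | _ = subsingleton⇒trivial (preimage-empty⇒subsingleton G N empty)
      ...   | yes (_ , a∈A) | yes A-proper = ⊥-elim (¬proper M-mod new∈M a∈A A-proper)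
      ...   | yes _ | no ¬proper′ = total⇒trivial (preimage-total⇒total G N new∈M λ x →
                decidable-stable (x ∈? preimage (_↑ˡ 1) M) λ x∉A → ¬proper′ (x , x∉A))

module _ {n : ℕ} (G : Graph n) (k₁ : Fin n) where

  IsLeastOfMinimalModule : Fin n → Set
  IsLeastOfMinimalModule u = ∃ λ K → IsMinimalModule G K × IsLeast K u

  isLeastOfMinimalModule? : Decidable IsLeastOfMinimalModule
  isLeastOfMinimalModule? u = anySubset? λ K → isMinimalModule? G K ×-dec isLeast? K u

  -- Taking the least vertex is just a decidable way to choose one vertex per minimal module.
  neighbourhood : Fin n → Bool
  neighbourhood u with isLeastOfMinimalModule? u | inMinimalModule? G u
  ... | yes _ | _     = true
  ... | no _  | yes _ = false
  ... | no _  | no _  = not (adj G u k₁)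

  neighbourhood-least : ∀ {u} → IsLeastOfMinimalModule u → neighbourhood u ≡ true
  neighbourhood-least {u} least with isLeastOfMinimalModule? u
  ... | yes _ = refl
  ... | no ¬least = contradiction least ¬least

  neighbourhood-nonleast : ∀ {u} → ¬ IsLeastOfMinimalModule u → InMinimalModule G u → neighbourhood u ≡ false
  neighbourhood-nonleast {u} ¬least u∈minimal with isLeastOfMinimalModule? u | inMinimalModule? G u
  ... | yes least | _ = contradiction least ¬least
  ... | no _ | yes _ = refl
  ... | no _ | no u∉minimal = contradiction u∈minimal u∉minimal

  neighbourhood-outside : ∀ {u} → ¬ InMinimalModule G u → neighbourhood u ≡ not (adj G u k₁)
  neighbourhood-outside {u} u∉minimal with isLeastOfMinimalModule? u | inMinimalModule? G u
  ... | yes (K , K-min , u∈K , _) | _ = contradiction (K , K-min , u∈K) u∉minimal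
  ... | no _ | yes u∈minimal = contradiction u∈minimal u∉minimal
  ... | no _ | no _ = refl

  -- Minimal modules are disjoint, so a vertex of K other than its least one is not least in any.
  neighbourhood-splits : TwinFree G → SplitsMinimalModules G neighbourhood
  neighbourhood-splits twinFree {K} K-min with IsMinimalModule.hasTwoElements K-min
  ... | two@(_ , _ , _ , x∈K , _) with least-element (_ , x∈K)
  ...   | m , m∈K , m≤ with another-element two m
  ...     | w , w∈K , w≢m = m , w , m∈K , w∈K , neighbourhood-least (K , K-min , m∈K , m≤) ,
                            neighbourhood-nonleast ¬least (K , K-min , w∈K)
    where
      ¬least : ¬ IsLeastOfMinimalModule w
      ¬least (K′ , K′-min , w∈K′ , w≤) =
        w≢m (≤ᶠ-antisym (w≤ m (minimal-overlap⇒⊆ G twinFree K-min K′-min w∈K w∈K′ m∈K)) (m≤ w w∈K))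

hasPrimeExt-0⇒isPrime : ∀ {n} {G : Graph n} → HasPrimeExt G 0 → IsPrime G
hasPrimeExt-0⇒isPrime {n} {G} (H , H-ext , 4≤n+0 , H-trivial) =
  subst (4 ≤_) (+-identityʳ n) 4≤n+0 , G-trivial
  where
    shrink : Fin (n + 0) → Fin n
    shrink = cast (+-identityʳ n)

    shrink-↑ˡ : ∀ x → shrink (x ↑ˡ 0) ≡ x
    shrink-↑ˡ x = toℕ-injective (trans (toℕ-cast _ (x ↑ˡ 0)) (toℕ-↑ˡ x 0))

    ↑ˡ-shrink : ∀ a → shrink a ↑ˡ 0 ≡ a
    ↑ˡ-shrink a = toℕ-injective (trans (toℕ-↑ˡ (shrink a) 0) (toℕ-cast _ a))

    adj-shrink : ∀ a b → adj G (shrink a) (shrink b) ≡ adj H a b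
    adj-shrink a b = trans (sym (H-ext (shrink a) (shrink b))) (cong₂ (adj H) (↑ˡ-shrink a) (↑ˡ-shrink b))

    G-trivial : ∀ M → IsModule G M → IsTrivial M
    G-trivial M M-mod
      with trivial⇒total⊎subsingleton (H-trivial _ (isModule-preimage {G = G} {F = H} shrink adj-shrink M-mod))
    ... | inj₁ total = total⇒trivial λ x → subst (_∈ M) (shrink-↑ˡ x) (∈-preimage⁻ (total (x ↑ˡ 0)))
    ... | inj₂ single = subsingleton⇒trivial λ {x} {y} x∈M y∈M →
      ↑ˡ-injective 0 x y (single (∈-preimage⁺ (subst (_∈ M) (sym (shrink-↑ˡ x)) x∈M))
                                 (∈-preimage⁺ (subst (_∈ M) (sym (shrink-↑ˡ y)) y∈M)))

proposition28 : ∀ {n} (G : Graph n) → ¬ IsPrime G → 4 ≤ n → IsMG G 1 → IsPrimeBound G 1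
proposition28 {n} G ¬prime 4≤n mG≡1 with ¬prime⇒minimalModule G 4≤n ¬prime
... | K₁ , K₁-min with IsMinimalModule.hasTwoElements K₁-min
...   | k₁ , _ , _ , k₁∈K₁ , _ = (extend G N , extend-isExtension G N , prime) , no-prime-0-extension
  where
    twinFree : TwinFree G
    twinFree = m≡1⇒twinFree G mG≡1
    N : Fin n → Bool
    N = neighbourhood G k₁
    prime : IsPrime (extend G N)
    prime = extend-isPrime twinFree K₁-min k₁∈K₁ (neighbourhood-splits G k₁ twinFree) (neighbourhood-outside G k₁) 4≤n
    no-prime-0-extension : ∀ q → q < 1 → ¬ HasPrimeExt G q
    no-prime-0-extension zero _ = ¬prime ∘ hasPrimeExt-0⇒isPrime {G = G}
    no-prime-0-extension (suc _) (s≤s ())
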